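{- Let $H=(V,E)$ be an $n$-uniform hypergraph, $r\geq 2$, $p\in(0,1/2)$, $c^0:V\to\{0,\dots,r-1\}$ and $\sigma:V\to[0,1]$ injective. If, with respect to $\sigma$ and $c^0$, there are no edges that are both degenerate and dangerous and there are no complete h-trees, then the recoloring algorithm run on input $(c^0,\sigma)$ returns a proper $r$-coloring of $H$ (no monochromatic edge).
   Context: Write $(m)_r$ for $m \bmod r$. Fix $p\in(0,1/2)$. Given an initial coloring $c^0:V\to\{0,\dots,r-1\}$ and an injective weight function $\sigma:V\to[0,1]$: a vertex $v$ is free if $\sigma(v)\leq p$; $v$ is a $j$-vertex if $c^0(v)=j$; the first vertex of a set of vertices is its vertex of minimum weight. The recoloring algorithm starts with $c=c^0$ and, while there exists an edge monochromatic under the current $c$ whose first vertex among the vertices not yet recolored is free, recolors that vertex $v$ by $c(v)\gets (c(v)+1)_r$; it then returns $c$. An edge $f$ is degenerate if it contains at least $n/2$ free vertices. It is dangerous if there is $i\in\{0,\dots,r-1\}$ (a dominating color of $f$) such that every non-free vertex of $f$ is an $i$-vertex and every free vertex of $f$ is an $i$-vertex or an $(i-1)_r$-vertex; a dangerous non-degenerate edge has a unique dominating color. An h-tree is a rooted tree in which each node $x$ is labelled by an edge $e(x)$ of $H$ and each tree edge $\{x_1,x_2\}$ is labelled by a vertex lying in $e(x_1)\cap e(x_2)$. An h-tree consisting of a single node $x$ is alternating if $e(x)$ is dangerous and not degenerate. An h-tree with root $x$ and direct subtrees (subtrees rooted at the children of the root) $t_0,\dots,t_{k-1}$ with roots $y_0,\dots,y_{k-1}$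 is alternating if: $e(x)$ is dangerous and not degenerate, with dominating color $i$; every $t_j$ is alternating; every $e(y_j)$ has dominating color $(i-1)_r$; for every $j$ the first $(i-1)_r$-vertex of $e(y_j)$ belongs to $e(x)$; and every free $(i-1)_r$-vertex of $e(x)$ is the first $(i-1)_r$-vertex of some $e(y_j)$. An alternating h-tree is downward complete if for every leaf $y$, with $i$ the dominating color of $e(y)$, $e(y)$ contains no free $(i-1)_r$-vertex. It is complete if moreover the root edge contains no free vertex initially colored with the root's dominating color.
   Formalization: The weight function $\sigma$ and the parameter $p$ take rational values instead of real ones. -}

module Defs where

open import Data.Nat as ℕ using (ℕ; zero; suc; _*_)
open import Data.Nat.DivMod using (_%_; m%n<n)
open import Data.Fin using (Fin; zero; suc; toℕ; fromℕ; fromℕ<; inject₁)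
open import Data.Fin.Subset as S using (Subset; _∈_; _∉_; _∩_; ∣_∣)
open import Data.Vec using (tabulate)
open import Data.Rational as ℚ using (ℚ)
open import Data.Rational.Properties using (_≤?_)
open import Data.List using (List; []; _∷_)
open import Data.List.Membership.Propositional renaming (_∈_ to _∈L_; _∉_ to _∉L_)
open import Data.List.Relation.Unary.Any using (Any)
open import Data.Product using (Σ; _×_; _,_; ∃; proj₁; proj₂)
open import Data.Sum using (_⊎_)
open import Relation.Nullary using (¬_; does)
open import Relation.Binary.PropositionalEquality using (_≡_; _≢_)
open import Relation.Binary.Construct.Closure.ReflexiveTransitive using (Star)

sucMod : ∀ {r} → Fin r → Fin r
sucMod {suc k} i = fromℕ< (m%n<n (suc (toℕ i)) (suc k))

predMod : ∀ {r} → Fin r → Fin r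
predMod {suc k} zero    = fromℕ k
predMod {suc k} (suc i) = inject₁ i

-- Hypergraph on vertex set Fin N with m edges e : Fin m → Subset N
-- (uniformity ∣ e j ∣ ≡ n is assumed in the statement),
-- r colours, initial colouring c0, weights σ, threshold p.
module Alg (N m n r : ℕ) (e : Fin m → Subset N) (c0 : Fin N → Fin r)
           (σ : Fin N → ℚ) (p : ℚ) where

  Free : Fin N → Set
  Free v = σ v ℚ.≤ p

  freeSet : Subset N
  freeSet = tabulate (λ v → does (σ v ≤? p))

  Degenerate : Fin m → Set
  Degenerate j = n ℕ.≤ 2 * ∣ e j ∩ freeSet ∣

  Dom : Fin m → Fin r → Set
  Dom j i = (∀ v → v ∈ e j → ¬ Free v → c0 v ≡ i)
          × (∀ v → v ∈ e j → Free v → (c0 v ≡ i) ⊎ (c0 v ≡ predMod i))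

  Dangerous : Fin m → Set
  Dangerous j = ∃ λ i → Dom j i

  IsFirst : (Fin N → Set) → Fin N → Set
  IsFirst P w = P w × (∀ u → P u → σ w ℚ.≤ σ u)

  FirstColVertex : Fin m → Fin r → Fin N → Set
  FirstColVertex j k = IsFirst (λ u → u ∈ e j × c0 u ≡ k)

  -- h-trees: nodes labelled by edges, tree edges labelled by vertices
  data HTree : Set where
    node : Fin m → List (Fin N × HTree) → HTree

  root : HTree → Fin m
  root (node j _) = j

  mutual
    data Alt : HTree → Fin r → Set where
      single : ∀ {j i} → ¬ Degenerate j → Dom j i → Alt (node j []) i
      branch : ∀ {j i ch} → ¬ Degenerate j → Dom j i → ch ≢ [] →
               AltChildren j i ch →
               (∀ w → w ∈ e j → Free w → c0 w ≡ predMod i →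
                  Any (λ lt → FirstColVertex (root (proj₂ lt)) (predMod i) w) ch) →
               Alt (node j ch) i

    data AltChildren (j : Fin m) (i : Fin r) : List (Fin N × HTree) → Set where
      []  : AltChildren j i []
      _∷_ : ∀ {l t ch} →
            (l ∈ e j × l ∈ e (root t)) ×
            Alt t (predMod i) ×
            (∃ λ w → FirstColVertex (root t) (predMod i) w × w ∈ e j) →
            AltChildren j i ch → AltChildren j i ((l , t) ∷ ch)

  mutual
    data DownComplete : HTree → Set where
      leaf  : ∀ {j} → (∀ i → Dom j i → ∀ w → w ∈ e j → Free w → c0 w ≢ predMod i) →
              DownComplete (node j [])
      inner : ∀ {j ch} → ch ≢ [] → DCChildren ch → DownComplete (node j ch)

    data DCChildren : List (Fin N × HTree) → Set where
      []  : DCChildren []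
      _∷_ : ∀ {l t ch} → DownComplete t → DCChildren ch → DCChildren ((l , t) ∷ ch)

  Complete : HTree → Set
  Complete t = Σ (Fin r) λ i → Alt t i × DownComplete t ×
               (∀ w → w ∈ e (root t) → Free w → c0 w ≢ i)

  -- the recolouring algorithm; state = (current colouring, recoloured vertices)
  State : Set
  State = (Fin N → Fin r) × List (Fin N)

  Monochromatic : (Fin N → Fin r) → Fin m → Set
  Monochromatic c j = ∀ u v → u ∈ e j → v ∈ e j → c u ≡ c v

  Eligible : State → Fin m → Fin N → Set
  Eligible (c , R) j v = Monochromatic c j × v ∈ e j × v ∉L R ×
                         (∀ u → u ∈ e j → u ∉L R → σ v ℚ.≤ σ u) × Free v

  Step : State → State → Set
  Step (c , R) (c' , R') = Σ (Fin m) λ j → Σ (Fin N) λ v → Eligible (c , R) j v ×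
    c' v ≡ sucMod (c v) × (∀ u → u ≢ v → c' u ≡ c u) × R' ≡ v ∷ R

  Terminal : State → Set
  Terminal s = ¬ (Σ (Fin m) λ j → Σ (Fin N) λ v → Eligible s j v)

  Reachable : State → Set
  Reachable s = Star Step (c0 , []) s

  Proper : (Fin N → Fin r) → Set
  Proper c = ∀ j → ¬ Monochromatic c j

{-# OPTIONS --safe #-}

-- Along a run, let R be the list of recoloured vertices. A vertex is recoloured at most once,
-- so the current colouring is c0 shifted by one exactly on R. When u is recoloured, its edge g
-- is monochromatic of colour c0 u; this forces g to be dangerous with dominating colour c0 u,
-- u to be the first c0 u-vertex of g, and every free (c0 u - 1)-vertex of g to lie in R
-- already. By induction along R, every recoloured u is thus the first c0 u-vertex of the root
-- of a downward complete alternating h-tree: hang below g the trees of its free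
-- (c0 u - 1)-vertices. An edge f still monochromatic of colour k at termination yields such a
-- tree in the same way, and it is complete: a free k-vertex of f would be unrecoloured, so the
-- first unrecoloured vertex of f would be lighter, hence free and eligible.
module Submission where

open import Defs
open import Data.Nat using (ℕ; _≤_)
open import Data.Fin using (Fin)
open import Data.Fin.Subset using (Subset; ∣_∣)
open import Data.Rational as ℚ using (ℚ; 0ℚ; 1ℚ; ½)
open import Data.Product using (Σ; _×_; proj₁)
open import Relation.Nullary using (¬_)
open import Relation.Binary.PropositionalEquality using (_≡_)
open import Function.Definitions using (Injective)

open import Function using (_∘_)
open import Data.Nat using (suc; s≤s; _*_)
open import Data.Nat.Properties using (1+n≢n; ≤-trans; m≤n*m)
open import Data.Nat.DivMod using (_%_; n%n≡0; m<n⇒m%n≡m)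
open import Data.Fin as F using (zero; suc; toℕ; fromℕ; fromℕ<; inject₁)
open import Data.Fin.Properties using (toℕ-injective; toℕ-fromℕ; toℕ-fromℕ<; toℕ-inject₁; toℕ<n; any?)
open import Data.Fin.Relation.Unary.Top using (view; ‵fromℕ; ‵inject₁)
open import Data.Fin.Subset using (_∈_; _∩_; _⊆_)
open import Data.Fin.Subset.Properties using (x∈p∩q⁺; p⊆q⇒∣p∣≤∣q∣; _∈?_)
open import Data.Rational.Properties as ℚₚ using () renaming (_≤?_ to _ℚ≤?_; ≤-trans to ℚ≤-trans)
open import Data.List using (List; []; _∷_; allFin; filter)
open import Data.List.Membership.Propositional using () renaming (_∈_ to _∈L_; _∉_ to _∉L_)
import Data.List.Membership.DecPropositional as DecMembership
open import Data.List.Membership.Propositional.Properties using (∈-allFin; ∈-filter⁺)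
open import Data.List.Relation.Unary.All as All using (All; []; _∷_)
open import Data.List.Relation.Unary.All.Properties using (all-filter)
open import Data.List.Relation.Unary.Any using (Any; here; there)
open import Data.List.Relation.Unary.Any.Properties using (¬Any[])
open import Relation.Binary.Bundles using (DecTotalOrder)
open import Data.List.Extrema (DecTotalOrder.totalOrder ℚₚ.≤-decTotalOrder)
  using (argmin; argmin-all; f[argmin]≤f[⊤]; f[argmin]≤f[xs])
open import Data.Product using (∃; _,_; proj₂)
open import Data.Sum using (_⊎_; inj₁; inj₂)
open import Relation.Nullary using (Dec; yes; no; ¬?; contradiction)
open import Relation.Nullary.Decidable using (dec-true; decidable-stable; _×-dec_)
open import Relation.Binary.PropositionalEquality
  using (_≢_; refl; sym; trans; cong; subst; module ≡-Reasoning)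
open import Relation.Binary.Construct.Closure.ReflexiveTransitive using (Star; ε; _◅_)
open import Data.Vec.Properties using (lookup∘tabulate; lookup⇒[]=)

sucMod-fromℕ : ∀ k → sucMod (fromℕ k) ≡ zero
sucMod-fromℕ k = toℕ-injective (begin
  toℕ (sucMod (fromℕ k))      ≡⟨ toℕ-fromℕ< _ ⟩
  suc (toℕ (fromℕ k)) % suc k ≡⟨ cong (λ x → suc x % suc k) (toℕ-fromℕ k) ⟩
  suc k % suc k               ≡⟨ n%n≡0 (suc k) ⟩
  0                           ∎)
  where open ≡-Reasoning

sucMod-inject₁ : ∀ {k} (j : Fin k) → sucMod (inject₁ j) ≡ suc j
sucMod-inject₁ {k} j = toℕ-injective (begin
  toℕ (sucMod (inject₁ j))       ≡⟨ toℕ-fromℕ< _ ⟩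
  suc (toℕ (inject₁ j)) % suc k  ≡⟨ cong (λ x → suc x % suc k) (toℕ-inject₁ j) ⟩
  suc (toℕ j) % suc k            ≡⟨ m<n⇒m%n≡m (s≤s (toℕ<n j)) ⟩
  suc (toℕ j)                    ∎)
  where open ≡-Reasoning

predMod-sucMod : ∀ {r} (i : Fin r) → predMod (sucMod i) ≡ i
predMod-sucMod {suc k} i with view i
... | ‵fromℕ     = cong predMod (sucMod-fromℕ k)
... | ‵inject₁ j = cong predMod (sucMod-inject₁ j)

sucMod≡⇒≡predMod : ∀ {r} {i k : Fin r} → sucMod i ≡ k → i ≡ predMod k
sucMod≡⇒≡predMod {i = i} refl = sym (predMod-sucMod i)

predMod-≢ : ∀ {r} → 2 ≤ r → (i : Fin r) → predMod i ≢ i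
predMod-≢ (s≤s (s≤s _)) zero    ()
predMod-≢ (s≤s (s≤s _)) (suc i) eq =
  1+n≢n (trans (sym (cong toℕ eq)) (toℕ-inject₁ i))

sucMod-≢ : ∀ {r} → 2 ≤ r → (i : Fin r) → sucMod i ≢ i
sucMod-≢ r2 i eq = predMod-≢ r2 i (sym (sucMod≡⇒≡predMod eq))

module Recolouring (N m n r : ℕ) (e : Fin m → Subset N) (c0 : Fin N → Fin r)
                   (σ : Fin N → ℚ) (p : ℚ) where
  open Alg N m n r e c0 σ p
  open DecMembership (F._≟_ {N}) using () renaming (_∈?_ to _∈L?_)

  free? : ∀ v → Dec (Free v)
  free? v = σ v ℚ≤? p

  free⇒∈freeSet : ∀ {v} → Free v → v ∈ freeSet
  free⇒∈freeSet {v} fv =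
    lookup⇒[]= v freeSet (trans (lookup∘tabulate _ v) (dec-true (free? v) fv))

  nonDegenerate⇒nonFree : ∀ {j} → ∣ e j ∣ ≡ n → ¬ Degenerate j →
                          ∃ λ v → v ∈ e j × ¬ Free v
  nonDegenerate⇒nonFree {j} ∣ej∣≡n nd with any? (λ v → (v ∈? e j) ×-dec ¬? (free? v))
  ... | yes found = found
  ... | no none   = contradiction degenerate nd
    where
    allFree : e j ⊆ e j ∩ freeSet
    allFree {v} v∈ =
      x∈p∩q⁺ (v∈ , free⇒∈freeSet (decidable-stable (free? v) (λ nf → none (v , v∈ , nf))))

    degenerate : Degenerate j
    degenerate = subst (_≤ 2 * ∣ e j ∩ freeSet ∣) ∣ej∣≡n
                   (≤-trans (p⊆q⇒∣p∣≤∣q∣ allFree) (m≤n*m _ 2))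

  Dom-unique : ∀ {j i k} → ∣ e j ∣ ≡ n → ¬ Degenerate j → Dom j i → Dom j k → i ≡ k
  Dom-unique ∣ej∣≡n nd (di , _) (dk , _) with nonDegenerate⇒nonFree ∣ej∣≡n nd
  ... | v , v∈ , nf = trans (sym (di v v∈ nf)) (dk v v∈ nf)

  Certifies : Fin r → Fin N → HTree → Set
  Certifies k u t = Alt t k × DownComplete t × FirstColVertex (root t) k u

  Certificate : Fin r → Fin N → Set
  Certificate k u = Σ HTree (Certifies k u)

  HangsAt : Fin m → Fin r → Fin N × HTree → Set
  HangsAt j k (l , t) = l ∈ e j × Certifies k l t

  CoversFree : Fin m → Fin r → List (Fin N × HTree) → Set
  CoversFree j k ts = ∀ w → w ∈ e j → Free w → c0 w ≡ k →
                      Any (λ lt → FirstColVertex (root (proj₂ lt)) k w) ts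

  hanging⇒AltChildren : ∀ {j i ts} → All (HangsAt j (predMod i)) ts → AltChildren j i ts
  hanging⇒AltChildren [] = []
  hanging⇒AltChildren ((l∈ , alt , _ , first) ∷ hanging) =
    ((l∈ , proj₁ (proj₁ first)) , alt , (_ , first , l∈)) ∷ hanging⇒AltChildren hanging

  hanging⇒DCChildren : ∀ {j k ts} → All (HangsAt j k) ts → DCChildren ts
  hanging⇒DCChildren [] = []
  hanging⇒DCChildren ((_ , _ , dc , _) ∷ hanging) = dc ∷ hanging⇒DCChildren hanging

  node-alternating : ∀ {j i} ts → ¬ Degenerate j → Dom j i →
                     All (HangsAt j (predMod i)) ts → CoversFree j (predMod i) ts →
                     Alt (node j ts) i
  node-alternating []      nd d _       _      = single nd d
  node-alternating (_ ∷ _) nd d hanging covers =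
    branch nd d (λ ()) (hanging⇒AltChildren hanging) covers

  node-downComplete : ∀ {j i k} ts → ∣ e j ∣ ≡ n → ¬ Degenerate j → Dom j i →
                      All (HangsAt j k) ts → CoversFree j (predMod i) ts →
                      DownComplete (node j ts)
  node-downComplete []      ∣ej∣≡n nd d _ covers = leaf λ i′ d′ w w∈ fw cw →
    ¬Any[] (covers w w∈ fw (subst (λ k → c0 w ≡ predMod k) (Dom-unique ∣ej∣≡n nd d′ d) cw))
  node-downComplete (_ ∷ _) _ _ _ hanging _ = inner (λ ()) (hanging⇒DCChildren hanging)

  Covered : List (Fin N) → Fin m → Fin r → Set
  Covered R j k = ∀ x → x ∈ e j → Free x → c0 x ≡ k → x ∈L R

  module Grow (R : List (Fin N)) (certified : ∀ {u} → u ∈L R → Certificate (c0 u) u)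
              (j : Fin m) (i : Fin r) (covered : Covered R j (predMod i)) where

    Candidate : Fin N → Set
    Candidate x = x ∈ e j × Free x × c0 x ≡ predMod i

    candidate? : ∀ x → Dec (Candidate x)
    candidate? x = (x ∈? e j) ×-dec free? x ×-dec (c0 x F.≟ predMod i)

    certificate : ∀ {x} → Candidate x → Certificate (predMod i) x
    certificate {x} (x∈ , fx , cx) =
      subst (λ k → Certificate k x) cx (certified (covered x x∈ fx cx))

    children : List (Fin N) → List (Fin N × HTree)
    children []       = []
    children (x ∷ xs) with candidate? x
    ... | yes cx = (x , proj₁ (certificate cx)) ∷ children xs
    ... | no _   = children xs

    children-hang : ∀ xs → All (HangsAt j (predMod i)) (children xs)
    children-hang []       = []
    children-hang (x ∷ xs) with candidate? x
    ... | yes cx = (proj₁ cx , proj₂ (certificate cx)) ∷ children-hang xs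
    ... | no _   = children-hang xs

    children-cover : ∀ {w} xs → w ∈L xs → Candidate w →
                     Any (λ lt → FirstColVertex (root (proj₂ lt)) (predMod i) w) (children xs)
    children-cover (x ∷ xs) (here refl) cw with candidate? x
    ... | yes cx  = here (proj₂ (proj₂ (proj₂ (certificate cx))))
    ... | no ¬cx = contradiction cw ¬cx
    children-cover (x ∷ xs) (there w∈) cw with candidate? x
    ... | yes _ = there (children-cover xs w∈ cw)
    ... | no _  = children-cover xs w∈ cw

    tree : HTree
    tree = node j (children (allFin N))

    tree-covers : CoversFree j (predMod i) (children (allFin N))
    tree-covers w w∈ fw cw = children-cover (allFin N) (∈-allFin w) (w∈ , fw , cw)

    tree-alternating : ¬ Degenerate j → Dom j i → Alt tree i
    tree-alternating nd d =
      node-alternating (children (allFin N)) nd d (children-hang (allFin N)) tree-covers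

    tree-downComplete : ∣ e j ∣ ≡ n → ¬ Degenerate j → Dom j i → DownComplete tree
    tree-downComplete ∣ej∣≡n nd d =
      node-downComplete (children (allFin N)) ∣ej∣≡n nd d (children-hang (allFin N)) tree-covers

  JustifiedBy : List (Fin N) → Fin N → Set
  JustifiedBy R u = Free u × Σ (Fin m) λ g →
    Dom g (c0 u) × FirstColVertex g (c0 u) u × Covered R g (predMod (c0 u))

  data Justified : List (Fin N) → Set where
    []  : Justified []
    _∷_ : ∀ {u R} → JustifiedBy R u → Justified R → Justified (u ∷ R)

  justified-free : ∀ {R u} → Justified R → u ∈L R → Free u
  justified-free ((fu , _) ∷ _) (here refl) = fu
  justified-free (_ ∷ just)     (there u∈)  = justified-free just u∈

  justified-certified : (∀ j → ¬ (Degenerate j × Dangerous j)) → (∀ j → ∣ e j ∣ ≡ n) →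
                        ∀ {R} → Justified R → ∀ {u} → u ∈L R → Certificate (c0 u) u
  justified-certified noDD uniform {u ∷ R} ((_ , g , d , first , covered) ∷ just) (here refl) =
    tree , tree-alternating nd d , tree-downComplete (uniform g) nd d , first
    where
    open Grow R (justified-certified noDD uniform just) g (c0 u) covered
    nd : ¬ Degenerate g
    nd deg = noDD g (deg , c0 u , d)
  justified-certified noDD uniform (_ ∷ just) (there u∈) =
    justified-certified noDD uniform just u∈

  record Shifted (R : List (Fin N)) (c : Fin N → Fin r) : Set where
    field
      shifted   : ∀ {u} → u ∈L R → c u ≡ sucMod (c0 u)
      unshifted : ∀ {u} → u ∉L R → c u ≡ c0 u

  Painted : (Fin N → Fin r) → Fin m → Fin r → Set
  Painted c j k = ∀ x → x ∈ e j → c x ≡ k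

  monochromatic⇒painted : ∀ {c j} → Fin r → Monochromatic c j → ∃ (Painted c j)
  monochromatic⇒painted {c} {j} default mono with any? (λ v → v ∈? e j)
  ... | yes (v , v∈) = c v , λ x x∈ → mono x v x∈ v∈
  ... | no none      = default , λ x x∈ → contradiction (x , x∈) none

  module _ (r2 : 2 ≤ r) {R c} (sh : Shifted R c) {j k} (painted : Painted c j k) where
    open Shifted sh

    painted-unshifted : ∀ {x} → x ∈ e j → c0 x ≡ k → x ∉L R
    painted-unshifted {x} x∈ refl x∈R =
      sucMod-≢ r2 (c0 x) (trans (sym (shifted x∈R)) (painted x x∈))

    painted-covered : Covered R j (predMod k)
    painted-covered x x∈ _ cx with x ∈L? R
    ... | yes x∈R = x∈R
    ... | no x∉R  = contradiction (trans (sym cx) (trans (sym (unshifted x∉R)) (painted x x∈)))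
                                  (predMod-≢ r2 k)

    painted-dominated : Justified R → Dom j k
    painted-dominated just = nonFree , free
      where
      nonFree : ∀ x → x ∈ e j → ¬ Free x → c0 x ≡ k
      nonFree x x∈ nf = trans (sym (unshifted (nf ∘ justified-free just))) (painted x x∈)
      free : ∀ x → x ∈ e j → Free x → c0 x ≡ k ⊎ c0 x ≡ predMod k
      free x x∈ _ with x ∈L? R
      ... | yes x∈R = inj₂ (sucMod≡⇒≡predMod (trans (sym (shifted x∈R)) (painted x x∈)))
      ... | no x∉R  = inj₁ (trans (sym (unshifted x∉R)) (painted x x∈))

  Invariant : State → Set
  Invariant (c , R) = Shifted R c × Justified R

  step-invariant : 2 ≤ r → ∀ {s s′} → Invariant s → Step s s′ → Invariant s′
  step-invariant r2 {c , R} (sh , just)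
                 (j , v , (mono , v∈ , v∉R , minimal , fv) , c′v , c′u , refl) =
    record { shifted = shifted′ ; unshifted = unshifted′ } ,
    (fv , j , painted-dominated r2 sh painted just , first , painted-covered r2 sh painted) ∷ just
    where
    open Shifted sh
    painted : Painted c j (c0 v)
    painted x x∈ = trans (mono x v x∈ v∈) (unshifted v∉R)

    first : FirstColVertex j (c0 v) v
    first = (v∈ , refl) , λ u (u∈ , cu) → minimal u u∈ (painted-unshifted r2 sh painted u∈ cu)

    shifted′ : ∀ {u} → u ∈L v ∷ R → _ ≡ sucMod (c0 u)
    shifted′ (here refl) = trans c′v (cong sucMod (unshifted v∉R))
    shifted′ {u} (there u∈R) = trans (c′u u (λ { refl → v∉R u∈R })) (shifted u∈R)

    unshifted′ : ∀ {u} → u ∉L v ∷ R → _ ≡ c0 u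
    unshifted′ {u} u∉ = trans (c′u u (u∉ ∘ here)) (unshifted (u∉ ∘ there))

  steps-invariant : 2 ≤ r → ∀ {s s′} → Invariant s → Star Step s s′ → Invariant s′
  steps-invariant r2 inv ε            = inv
  steps-invariant r2 inv (step ◅ run) = steps-invariant r2 (step-invariant r2 inv step) run

  initial-invariant : Invariant (c0 , [])
  initial-invariant = record { shifted = λ () ; unshifted = λ _ → refl } , []

  reachable-invariant : 2 ≤ r → ∀ {s} → Reachable s → Invariant s
  reachable-invariant r2 = steps-invariant r2 initial-invariant

  terminal-monochromatic⇒unshifted-nonFree : ∀ {c R j w} → Terminal (c , R) →
                                              Monochromatic c j → w ∈ e j → w ∉L R → ¬ Free w
  terminal-monochromatic⇒unshifted-nonFree {c} {R} {j} {w} term mono w∈ w∉R fw =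
    term (j , v , (mono , proj₁ v-unshifted , proj₂ v-unshifted , minimal , ℚ≤-trans v≤w fw))
    where
    Unshifted : Fin N → Set
    Unshifted u = u ∈ e j × u ∉L R
    unshifted? : ∀ u → Dec (Unshifted u)
    unshifted? u = (u ∈? e j) ×-dec ¬? (u ∈L? R)
    candidates : List (Fin N)
    candidates = filter unshifted? (allFin N)
    v : Fin N
    v = argmin σ w candidates
    v≤w : σ v ℚ.≤ σ w
    v≤w = f[argmin]≤f[⊤] {f = σ} w candidates
    v-unshifted : Unshifted v
    v-unshifted = argmin-all σ (w∈ , w∉R) (all-filter unshifted? (allFin N))
    minimal : ∀ u → u ∈ e j → u ∉L R → σ v ℚ.≤ σ u
    minimal u u∈ u∉R =
      All.lookup (f[argmin]≤f[xs] {f = σ} w candidates)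
                 (∈-filter⁺ unshifted? (∈-allFin u) (u∈ , u∉R))

  terminal-monochromatic⇒complete : 2 ≤ r → (∀ j → ¬ (Degenerate j × Dangerous j)) →
                                    (∀ j → ∣ e j ∣ ≡ n) →
                                    ∀ {c R j} → Invariant (c , R) → Terminal (c , R) →
                                    Monochromatic c j → Σ HTree Complete
  terminal-monochromatic⇒complete r2 noDD uniform {R = R} {j} (sh , just) term mono
    with monochromatic⇒painted (fromℕ< r2) mono
  ... | k , painted =
    tree , k , tree-alternating nd dom , tree-downComplete (uniform j) nd dom , noFreeRootColour
    where
    dom : Dom j k
    dom = painted-dominated r2 sh painted just
    nd : ¬ Degenerate j
    nd deg = noDD j (deg , k , dom)
    open Grow R (justified-certified noDD uniform just) j k (painted-covered r2 sh painted)
    noFreeRootColour : ∀ w → w ∈ e j → Free w → c0 w ≢ k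
    noFreeRootColour w w∈ fw cw = terminal-monochromatic⇒unshifted-nonFree
      term mono w∈ (painted-unshifted r2 sh painted w∈ cw) fw

corollary1 : (N m n r : ℕ) (e : Fin m → Subset N) → (∀ j → ∣ e j ∣ ≡ n) →
    2 ≤ r → (p : ℚ) → 0ℚ ℚ.< p → p ℚ.< ½ →
    (c0 : Fin N → Fin r) (σ : Fin N → ℚ) →
    (∀ v → 0ℚ ℚ.≤ σ v × σ v ℚ.≤ 1ℚ) → Injective _≡_ _≡_ σ →
    let open Alg N m n r e c0 σ p in
    (∀ j → ¬ (Degenerate j × Dangerous j)) →
    ¬ (Σ HTree Complete) →
    ∀ s → Reachable s → Terminal s → Proper (proj₁ s)
corollary1 N m n r e uniform r2 p _ _ c0 σ _ _ noDD noComplete _ reach term _ mono =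
  noComplete (terminal-monochromatic⇒complete r2 noDD uniform (reachable-invariant r2 reach) term mono)
  where open Recolouring N m n r e c0 σ p
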